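{- Let $m\ge1$ and let $a,b$ be the two vertices of the part of size $2$ of the complete bipartite graph $K_{2,m}$, using the same ordering of their common neighbourhood: $\sigma_a=\sigma_b$. Let $U=RC$ be the Grover coined walk on $K_{2,m}$ with marked vertices $a$ and $b$, where $C_a=C_b$ is any reflection. Then for every subspace $W$ of $\operatorname{col}(C_a+I)$ there is pointwise perfect $W$-transfer from $a$ to $b$ at time $t=2$.
   Context: For a graph $X$, arcs are ordered pairs $(u,v)$ with $u\sim v$. For each vertex $u$ fix a bijection $\sigma_u:\{1,\dots,\deg(u)\}\to\{v:v\sim u\}$, identifying $\mathbb{C}^{\deg(u)}$ with functions on the outgoing arcs of $u$ via $e_j\mapsto e_{(u,\sigma_u(j))}$. $R$ is the permutation matrix with $Re_{(u,v)}=e_{(v,u)}$; $C$ is block diagonal with block $C_u$ acting on the outgoing arcs of $u$; $U=RC$. The Grover coined walk with marked vertices $a,b$ has $C_u=\frac{2}{\deg(u)}J-I$ for $u\notin\{a,b\}$ ($J$ the all-ones matrix), while $C_a,C_b$ are given reflections (Hermitian with square $I$). For $w$ with $C_aw=w$, the coin state is $x_a(w)=\sum_jw_je_{(a,\sigma_a(j))}$. Pointwise perfect $W$-transfer from $a$ to $b$ at time $t$ means: for every $w\in W$ there is a unimodular $\gamma\in\mathbb{C}$ with $U^tx_a(w)=\gamma x_b(w)$. -}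

module Defs where

open import Level using (Level; _⊔_)
import Level
open import Data.Nat as ℕ using (ℕ; zero; suc; NonZero)
open import Data.Fin using (Fin; zero; suc)
open import Data.Product using (Σ; _×_; _,_; ∃)
open import Function.Bundles using (_↔_; Inverse)
import Data.Fin
import Relation.Nullary
open import Algebra.Bundles using (CommutativeRing)

-- The paper works over ℂ.  ℂ is not available in agda-stdlib,
-- so we work over an arbitrary commutative ring equipped with an
-- involution (complex conjugation) and inverses of the positive
-- integers (needed for the Grover coefficient 2/deg(u)).  ℂ with
-- complex conjugation is an instance.

natR : ∀ {c ℓ} (R : CommutativeRing c ℓ) → ℕ → CommutativeRing.Carrier R
natR R zero    = CommutativeRing.0# R
natR R (suc n) = CommutativeRing._+_ R (CommutativeRing.1# R) (natR R n)

record Scalars (c ℓ : Level) : Set (Level.suc (c ⊔ ℓ)) where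
  field
    scalarRing : CommutativeRing c ℓ
  open CommutativeRing scalarRing public using (Carrier; _≈_; _+_; _*_; _-_; 0#; 1#)
  field
    conj        : Carrier → Carrier
    conj-cong   : ∀ {x y} → x ≈ y → conj x ≈ conj y
    conj-invol  : ∀ x → conj (conj x) ≈ x
    conj-+      : ∀ x y → conj (x + y) ≈ conj x + conj y
    conj-*      : ∀ x y → conj (x * y) ≈ conj x * conj y
    conj-1      : conj 1# ≈ 1#

  field
    natInv      : (d : ℕ) → .{{NonZero d}} → Carrier
    natInv-inv  : (d : ℕ) .{{nz : NonZero d}} → natR scalarRing d * natInv d ≈ 1#

  sumF : ∀ {n} → (Fin n → Carrier) → Carrier
  sumF {zero}  f = 0#
  sumF {suc n} f = f zero + sumF (λ i → f (suc i))

  Unimodular : Carrier → Set ℓ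
  Unimodular γ = γ * conj γ ≈ 1#

module _ {c ℓ} (S : Scalars c ℓ) where
  open Scalars S

  Mat : ℕ → Set c
  Mat m = Fin m → Fin m → Carrier

  Vect : ℕ → Set c
  Vect m = Fin m → Carrier

  δ : ∀ {m} → Fin m → Fin m → Carrier
  δ zero    zero    = 1#
  δ zero    (suc _) = 0#
  δ (suc _) zero    = 0#
  δ (suc i) (suc j) = δ i j

  _·ᴹ_ : ∀ {m} → Mat m → Vect m → Vect m
  (A ·ᴹ v) i = sumF (λ k → A i k * v k)

  _≈ᵛ_ : ∀ {m} → Vect m → Vect m → Set ℓ
  v ≈ᵛ w = ∀ i → v i ≈ w i

  Hermitian : ∀ {m} → Mat m → Set ℓ
  Hermitian A = ∀ i j → A i j ≈ conj (A j i)

  IsReflection : ∀ {m} → Mat m → Set ℓ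
  IsReflection A = Hermitian A × (∀ i j → sumF (λ k → A i k * A k j) ≈ δ i j)

  InColPlusI : ∀ {m} → Mat m → Vect m → Set (c ⊔ ℓ)
  InColPlusI A w = ∃ λ (v : Vect _) → w ≈ᵛ (λ i → (A ·ᴹ v) i + v i)

  record IsSubspace {m} (W : Vect m → Set (c ⊔ ℓ)) : Set (c ⊔ ℓ) where
    field
      resp  : ∀ {v w} → v ≈ᵛ w → W v → W w
      zero∈ : W (λ _ → 0#)
      +∈    : ∀ {v w} → W v → W w → W (λ i → v i + w i)
      *∈    : ∀ λ' {v} → W v → W (λ i → λ' * v i)

  -- Vertices: the part of size 2
  -- is Fin 2 (a = zero, b = suc zero), the part of size m is Fin m.
  -- Arcs:  out i j  is the arc (i , j)  from the 2-side vertex i to j,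
  --        back j i is the arc (j , i)  from the m-side vertex j to i.

  data Arc (m : ℕ) : Set where
    out  : Fin 2 → Fin m → Arc m
    back : Fin m → Fin 2 → Arc m

  State : ℕ → Set c
  State m = Arc m → Carrier

  _≈ˢ_ : ∀ {m} → State m → State m → Set ℓ
  f ≈ˢ g = ∀ e → f e ≈ g e

  Rop : ∀ {m} → State m → State m
  Rop f (out i j)  = f (back j i)
  Rop f (back j i) = f (out i j)

  -- Both marked vertices a,b use the same matrix Ca, in the
  -- common ordering σ (σ_a = σ_b = σ) of their neighbourhood Fin m;
  -- every unmarked vertex j has degree 2 and uses the Grover coin
  -- (2/2) J - I (which does not depend on the ordering σ_j).
  Cop : ∀ {m} → (σ : Fin m ↔ Fin m) → Mat m → State m → State m
  Cop σ Ca f (out i v) =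
    sumF (λ k → Ca (Inverse.from σ v) k * f (out i (Inverse.to σ k)))
  Cop σ Ca f (back j i) =
    (natR scalarRing 2 * natInv 2) * (f (back j zero) + f (back j (suc zero))) - f (back j i)

  Uop : ∀ {m} → (σ : Fin m ↔ Fin m) → Mat m → State m → State m
  Uop σ Ca f = Rop (Cop σ Ca f)

  Upow : ∀ {m} → (σ : Fin m ↔ Fin m) → Mat m → ℕ → State m → State m
  Upow σ Ca zero    f = f
  Upow σ Ca (suc t) f = Uop σ Ca (Upow σ Ca t f)

  -- coin state x_u(w) = Σ_j w_j e_(u, σ_u(j)) for a marked vertex u
  coinState : ∀ {m} → (σ : Fin m ↔ Fin m) → Fin 2 → Vect m → State m
  coinState σ u w (out i v) with u Data.Fin.≟ i
  ... | Relation.Nullary.yes _ = w (Inverse.from σ v)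
  ... | Relation.Nullary.no  _ = 0#
  coinState σ u w (back _ _) = 0#

  PointwisePerfectTransfer : ∀ {m} → (σ : Fin m ↔ Fin m) → Mat m →
    (Vect m → Set (c ⊔ ℓ)) → ℕ → Set (c ⊔ ℓ)
  PointwisePerfectTransfer σ Ca W t =
    ∀ w → W w → Σ Carrier λ γ → Unimodular γ ×
      (Upow σ Ca t (coinState σ zero w) ≈ˢ (λ e → γ * coinState σ (suc zero) w e))

-- Since C_a is an involution, it fixes every w in col(C_a + I), so the first
-- step of the walk only reflects x_a(w) onto the arcs (j, a) entering a.  Every
-- vertex j of the m-side has degree 2, and the Grover coin (2/2)J - I of a
-- degree-2 vertex swaps its two arcs; the second reflection therefore carries
-- the state from (j, a) to (b, j), i.e. U² x_a(w) = x_b(w) and γ = 1.  The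
-- argument is vector by vector.
module Submission where

open import Defs
open import Level using (_⊔_)
open import Data.Nat using (ℕ; _≥_)
open import Data.Fin using (Fin; zero; suc; opposite; _≟_)
open import Data.Product using (_,_)
open import Function.Bundles using (_↔_; Inverse)
open import Algebra.Bundles using (CommutativeRing)
open import Relation.Nullary using (yes; no)
open import Relation.Binary.PropositionalEquality as ≡ using (_≡_)
import Data.Fin
import Algebra.Properties.AbelianGroup as AbelianGroupProperties
import Algebra.Properties.Semiring.Sum as SemiringSum
import Relation.Binary.Reasoning.Setoid as SetoidReasoning

module GroverK2m {c ℓ} (S : Scalars c ℓ) where
  open Scalars S
  open CommutativeRing scalarRing
    using (setoid; sym; trans; reflexive; +-cong; +-congʳ; *-congˡ; *-congʳ; *-assoc; +-comm;
           *-identityˡ; +-identityˡ; +-identityʳ; zeroˡ; zeroʳ; distribˡ; -‿cong; semiring; +-abelianGroup)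
  open SemiringSum semiring using (sum; sum-cong-≋; sum-replicate-zero; ∑-distrib-+; ∑-comm;
                                   *-distribˡ-sum; *-distribʳ-sum)
  open AbelianGroupProperties +-abelianGroup using (xyx⁻¹≈y; //-rightDividesʳ)
  open SetoidReasoning setoid

  infixr 7 _·_
  infix  4 _≈ᵥ_ _≈ₛ_

  _·_ : ∀ {n} → Mat S n → Vect S n → Vect S n
  _·_ = _·ᴹ_ S

  _≈ᵥ_ : ∀ {n} → Vect S n → Vect S n → Set ℓ
  _≈ᵥ_ = _≈ᵛ_ S

  _≈ₛ_ : ∀ {m} → State S m → State S m → Set ℓ
  _≈ₛ_ = _≈ˢ_ S

  sumF≡sum : ∀ {n} (f : Fin n → Carrier) → sumF f ≡ sum f
  sumF≡sum {ℕ.zero}  f = ≡.refl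
  sumF≡sum {ℕ.suc n} f = ≡.cong (f zero +_) (sumF≡sum (λ i → f (suc i)))

  sumF≈sum : ∀ {n} (f : Fin n → Carrier) → sumF f ≈ sum f
  sumF≈sum f = reflexive (sumF≡sum f)

  sumF-cong : ∀ {n} {f g : Fin n → Carrier} → (∀ i → f i ≈ g i) → sumF f ≈ sumF g
  sumF-cong {f = f} {g} f≈g = begin
    sumF f ≈⟨ sumF≈sum f ⟩
    sum f  ≈⟨ sum-cong-≋ f≈g ⟩
    sum g  ≈⟨ sumF≈sum g ⟨
    sumF g ∎

  sumF-zero : ∀ {n} {f : Fin n → Carrier} → (∀ i → f i ≈ 0#) → sumF f ≈ 0#
  sumF-zero {n} f≈0 = trans (sumF-cong f≈0) (trans (sumF≈sum {n} _) (sum-replicate-zero n))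

  sumF-+ : ∀ {n} (f g : Fin n → Carrier) → sumF (λ i → f i + g i) ≈ sumF f + sumF g
  sumF-+ f g = begin
    sumF (λ i → f i + g i) ≈⟨ sumF≈sum (λ i → f i + g i) ⟩
    sum (λ i → f i + g i)  ≈⟨ ∑-distrib-+ f g ⟩
    sum f + sum g          ≈⟨ +-cong (sumF≈sum f) (sumF≈sum g) ⟨
    sumF f + sumF g        ∎

  sumF-δ : ∀ {n} (i : Fin n) (v : Fin n → Carrier) → sumF (λ l → δ S i l * v l) ≈ v i
  sumF-δ {ℕ.suc n} zero    v = trans (+-cong (*-identityˡ _) (sumF-zero {n} (λ _ → zeroˡ _))) (+-identityʳ _)
  sumF-δ {ℕ.suc n} (suc i) v = trans (+-cong (zeroˡ _) (sumF-δ i (λ l → v (suc l)))) (+-identityˡ _)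

  ·ᴹ-assoc : ∀ {n} (A B : Mat S n) (v : Vect S n) (i : Fin n) →
    sumF (λ k → A i k * sumF (λ l → B k l * v l)) ≈ sumF (λ l → sumF (λ k → A i k * B k l) * v l)
  ·ᴹ-assoc {n} A B v i = begin
    sumF (λ k → A i k * sumF (λ l → B k l * v l))
      ≈⟨ trans (sumF-cong {n} (λ k → *-congˡ (sumF≈sum {n} _))) (sumF≈sum {n} _) ⟩
    sum (λ k → A i k * sum (λ l → B k l * v l))
      ≈⟨ sum-cong-≋ {n} (λ k → *-distribˡ-sum {n} (A i k) _) ⟩
    sum (λ k → sum (λ l → A i k * (B k l * v l)))
      ≈⟨ ∑-comm {n} {n} _ ⟩
    sum (λ l → sum (λ k → A i k * (B k l * v l)))
      ≈⟨ sum-cong-≋ {n} (λ l → sum-cong-≋ {n} (λ k → sym (*-assoc _ _ _))) ⟩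
    sum (λ l → sum (λ k → (A i k * B k l) * v l))
      ≈⟨ sum-cong-≋ {n} (λ l → *-distribʳ-sum {n} (v l) _) ⟨
    sum (λ l → sum (λ k → A i k * B k l) * v l)
      ≈⟨ trans (sumF-cong {n} (λ l → *-congʳ (sumF≈sum {n} _))) (sumF≈sum {n} _) ⟨
    sumF (λ l → sumF (λ k → A i k * B k l) * v l) ∎

  involution-fixes-colPlusI : ∀ {n} (A : Mat S n) → (∀ i j → sumF (λ k → A i k * A k j) ≈ δ S i j) →
    ∀ {w} → InColPlusI S A w → A · w ≈ᵥ w
  involution-fixes-colPlusI {n} A A²≈I {w} (v , w≈Av+v) i = begin
    sumF (λ k → A i k * w k)
      ≈⟨ sumF-cong {n} (λ k → trans (*-congˡ (w≈Av+v k)) (distribˡ _ _ _)) ⟩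
    sumF (λ k → A i k * sumF (λ l → A k l * v l) + A i k * v k)
      ≈⟨ sumF-+ {n} _ _ ⟩
    sumF (λ k → A i k * sumF (λ l → A k l * v l)) + sumF (λ k → A i k * v k)
      ≈⟨ +-congʳ (·ᴹ-assoc A A v i) ⟩
    sumF (λ l → sumF (λ k → A i k * A k l) * v l) + sumF (λ k → A i k * v k)
      ≈⟨ +-congʳ (trans (sumF-cong {n} (λ l → *-congʳ (A²≈I i l))) (sumF-δ i v)) ⟩
    v i + sumF (λ k → A i k * v k)
      ≈⟨ +-comm _ _ ⟩
    sumF (λ k → A i k * v k) + v i
      ≈⟨ w≈Av+v i ⟨
    w i ∎

  2*½*x≈x : ∀ x → natR scalarRing 2 * natInv 2 * x ≈ x
  2*½*x≈x x = trans (*-congʳ (natInv-inv 2)) (*-identityˡ x)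

  module Walk {m : ℕ} (σ : Fin m ↔ Fin m) (Ca : Mat S m) where
    open Inverse σ using (to; from; strictlyInverseʳ)

    R C : State S m → State S m
    R = Rop S
    C = Cop S σ Ca

    x : Fin 2 → Vect S m → State S m
    x = coinState S σ

    R-cong : ∀ {f g} → f ≈ₛ g → R f ≈ₛ R g
    R-cong f≈g (out i j)  = f≈g (back j i)
    R-cong f≈g (back j i) = f≈g (out i j)

    C-cong : ∀ {f g} → f ≈ₛ g → C f ≈ₛ C g
    C-cong f≈g (out i v)  = sumF-cong {m} (λ k → *-congˡ (f≈g (out i (to k))))
    C-cong f≈g (back j i) =
      +-cong (*-congˡ (+-cong (f≈g (back j zero)) (f≈g (back j (suc zero))))) (-‿cong (f≈g (back j i)))

    grover-swaps : ∀ f j i → C f (back j i) ≈ f (back j (opposite i))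
    grover-swaps f j zero       = trans (+-congʳ (2*½*x≈x _)) (xyx⁻¹≈y _ _)
    grover-swaps f j (suc zero) = trans (+-congʳ (2*½*x≈x _)) (//-rightDividesʳ _ _)

    C-fixes-coinState : ∀ u {w} → Ca · w ≈ᵥ w → C (x u w) ≈ₛ x u w
    C-fixes-coinState u {w} Caw≈w (out i v) with u ≟ i
    ... | yes _ = trans (sumF-cong {m} (λ k → *-congˡ (reflexive (≡.cong w (strictlyInverseʳ k)))))
                        (Caw≈w (from v))
    ... | no _  = sumF-zero {m} (λ _ → zeroʳ _)
    C-fixes-coinState u {w} Caw≈w (back j i) = grover-swaps (x u w) j i

    coinState-opposite : ∀ w i j → x zero w (out (opposite i) j) ≡ x (suc zero) w (out i j)
    coinState-opposite w zero       j = ≡.refl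
    coinState-opposite w (suc zero) j = ≡.refl

    CR-transfers : ∀ w → C (R (x zero w)) ≈ₛ R (x (suc zero) w)
    CR-transfers w (out i v)  = sumF-zero {m} (λ _ → zeroʳ _)
    CR-transfers w (back j i) =
      trans (grover-swaps (R (x zero w)) j i) (reflexive (coinState-opposite w i j))

    CRC-transfers : ∀ {w} → Ca · w ≈ᵥ w → C (R (C (x zero w))) ≈ₛ R (x (suc zero) w)
    CRC-transfers {w} Caw≈w e =
      trans (C-cong (R-cong (C-fixes-coinState zero Caw≈w)) e) (CR-transfers w e)

    U²-transfers : ∀ {w} → Ca · w ≈ᵥ w → Upow S σ Ca 2 (x zero w) ≈ₛ x (suc zero) w
    U²-transfers Caw≈w (out i j)  = CRC-transfers Caw≈w (back j i)
    U²-transfers Caw≈w (back j i) = CRC-transfers Caw≈w (out i j)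

mainTheorem4 : ∀ {c ℓ} (S : Scalars c ℓ) (m : ℕ) → m ≥ 1 →
    (σ : Data.Fin.Fin m ↔ Data.Fin.Fin m) (Ca : Mat S m) → IsReflection S Ca →
    (W : Vect S m → Set (c ⊔ ℓ)) → IsSubspace S W →
    (∀ w → W w → InColPlusI S Ca w) →
    PointwisePerfectTransfer S σ Ca W 2
mainTheorem4 S _ _ σ Ca (_ , Ca²≈I) _ _ W⊆col w w∈W = 1# , 1-unimodular , transfer
  where
  open Scalars S
  open CommutativeRing scalarRing using (trans; sym; *-identityˡ)
  open GroverK2m S
  open Walk σ Ca

  1-unimodular : Unimodular 1#
  1-unimodular = trans (*-identityˡ _) conj-1

  transfer : Upow S σ Ca 2 (x zero w) ≈ₛ (λ e → 1# * x (suc zero) w e)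
  transfer e = trans (U²-transfers (involution-fixes-colPlusI Ca Ca²≈I (W⊆col w w∈W)) e)
                     (sym (*-identityˡ _))
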